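{- Let $\alpha$ be a positive integer and take $\beta=1$. Let $g_k=g_k^{\alpha,1}$ be defined by $g_1=1$, $g_2=\alpha$, $g_{k+2}=\alpha g_{k+1}+g_k$ for $k\ge 1$, and let $\gamma=\gamma_{\alpha,1}=\frac{1}{2}(\alpha+\sqrt{\alpha^2+4})$. For positive integers $a_1,a_2$ let $w_k(a_1,a_2)=w_k^{\alpha,1}(a_1,a_2)$ be the sequence with $w_1=a_1$, $w_2=a_2$, $w_{k+2}=\alpha w_{k+1}+w_k$. Let $s(n)=s^{\alpha,1}(n)$ be the largest $s$ such that $w_s(a_1,a_2)=n$ for some $a_1,a_2\ge 1$, and call a pair $(b',a')$ of positive integers $(n,\alpha,1)$-good if $w_{s(n)}(b',a')=n$. Let $n$ be such that $s=s^{\alpha,1}(n)>2$, and let $a,b,t$ be the integers given by the characterization theorem specialized to $\beta=1$ (namely the unique integers with $n=ag_t+bg_{t-1}$, $t\ge 2$, $a\le \alpha b$, $b\le g_t$; for these, $(b,a)$ is $(n,\alpha,1)$-good and $s=t+1$). Then: \begin{itemize} \item The values $a,b,t$ are the unique integers satisfying $n=ag_t+bg_{t-1}$, $t\ge 2$, and $1\le a\le \alpha b\le \alpha g_t$. \item Every $(n,\alpha,1)$-good pair $(b',a')$ is of the form $(b+kg_t,\,a-kg_{t-1})$ for some integer $k\ge 0$. \item For such an $(n,\alpha,1)$-good pair $(b',a')=(b+kg_t,\,a-kg_{t-1})$ with $k\ge 0$, we have $w_{s+1}(b',a')=\lfloor \gamma n\rfloor-k$ if and only if $t$ is even, and $w_{s+1}(b',a')=\lceil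 \gamma n\rceil+k$ if and only if $t$ is odd. \end{itemize}
   Context: Specialization of the characterization theorem to $\beta=1$. For general relatively prime $\alpha,\beta$, that theorem states: if $s(n)>2$ then there are unique integers $a,b,t$ with $n=ag_t+\beta b g_{t-1}$, $t\ge 2$, $a\le(\beta-1)g_{t+1}+\alpha b$, $b\le g_t$, and $a-\alpha b-\ell g_{t+1}$ not a positive multiple of $\beta$ for any $\ell\ge 0$; moreover $(b,a)$ is $n$-good, $s=t+1$, every $n$-good pair is $(b+kg_t,a-k\beta g_{t-1})$ for some $k\ge 0$, and $w_{s+1}(b',a')-w_{s+1}(b,a)=k(-\beta)^t$. When $\beta=1$ the divisibility condition is automatic. -}

module Defs where

open import Data.Nat using (ℕ; zero; suc; _+_; _*_; _≤_; _<_)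
open import Data.Product using (Σ; _×_; _,_; proj₁; proj₂)
open import Relation.Binary.PropositionalEquality using (_≡_)

-- g_k = g_k^{α,1}:  g_1 = 1, g_2 = α, g_{k+2} = α g_{k+1} + g_k.
-- (g_0 = 0 is the natural backward extension; it is never used below,
--  since only g_t, g_{t-1}, g_{t+1} with t ≥ 2 occur.)
g : ℕ → ℕ → ℕ
g α zero = 0
g α (suc zero) = 1
g α (suc (suc k)) = α * g α (suc k) + g α k

-- wpair α k a₁ a₂ = (w_{k+1}, w_{k+2})
wpair : ℕ → ℕ → ℕ → ℕ → ℕ × ℕ
wpair α zero a₁ a₂ = a₁ , a₂
wpair α (suc k) a₁ a₂ =
  let p = wpair α k a₁ a₂ in proj₂ p , α * proj₂ p + proj₁ p

-- w_k(a₁,a₂) = w_k^{α,1}(a₁,a₂): w_1 = a₁, w_2 = a₂,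
-- w_{k+2} = α w_{k+1} + w_k.  (Sequence is 1-indexed; index 0 is junk = 0
-- and is excluded explicitly wherever indices are quantified.)
w : ℕ → ℕ → ℕ → ℕ → ℕ
w α zero a₁ a₂ = 0
w α (suc k) a₁ a₂ = proj₁ (wpair α k a₁ a₂)

IsS : ℕ → ℕ → ℕ → Set
IsS α n s =
  (1 ≤ s × Σ ℕ (λ a₁ → Σ ℕ (λ a₂ → 1 ≤ a₁ × 1 ≤ a₂ × w α s a₁ a₂ ≡ n)))
  × (∀ s′ a₁ a₂ → 1 ≤ s′ → 1 ≤ a₁ → 1 ≤ a₂ → w α s′ a₁ a₂ ≡ n → s′ ≤ s)

Good : ℕ → ℕ → ℕ → ℕ → Set
Good α n b′ a′ =
  Σ ℕ (λ s → IsS α n s × (1 ≤ b′ × 1 ≤ a′ × w α s b′ a′ ≡ n))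

-- Comparisons of a natural number m with the real number γ·n, where
-- γ = γ_{α,1} = (α + √(α²+4))/2 is the positive root of x² = αx + 1.
-- Since γn is the positive root of x² − αn·x − n² (the other root is ≤ 0),
-- for m ≥ 0 we have  m ≤ γn ⇔ m² ≤ αn·m + n²  and  γn ≤ m ⇔ αn·m + n² ≤ m².
_≤γ·_[α=_] : ℕ → ℕ → ℕ → Set
m ≤γ· n [α= α ] = m * m ≤ α * n * m + n * n

γ·_≤_[α=_] : ℕ → ℕ → ℕ → Set
γ· n ≤ m [α= α ] = α * n * m + n * n ≤ m * m

-- F = ⌊γ n⌋ : the largest integer ≤ γ n (γ n ≥ 0, so it suffices to range over ℕ).
IsFloorγ : ℕ → ℕ → ℕ → Set
IsFloorγ α n F = F ≤γ· n [α= α ] × (∀ m → m ≤γ· n [α= α ] → m ≤ F)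

IsCeilγ : ℕ → ℕ → ℕ → Set
IsCeilγ α n C = γ· n ≤ C [α= α ] × (∀ m → γ· n ≤ m [α= α ] → C ≤ m)

Even : ℕ → Set
Even t = Σ ℕ (λ k → t ≡ k + k)

Odd : ℕ → Set
Odd t = Σ ℕ (λ k → t ≡ suc (k + k))

{-# OPTIONS --safe #-}
-- Since g_t and g_{t-1} are coprime, two representations y g_t + x g_{t-1} of n
-- differ by a multiple of (−g_{t-1}, g_t).  With n = a g_t + b g_{t-1}, 1 ≤ a ≤ αb
-- and b ≤ g_t this forces every representation with x ≥ 1 to be
-- (a − k g_{t-1}, b + k g_t) with k ≥ 0, hence y ≤ αx.  For m > t + 1 we have
-- w_m(x, y) = w_{t+1}(x′, y′) = y′ g_t + x′ g_{t-1} with y′ > αx′, so s = t + 1, and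
-- the good pairs are the representations above.
-- For w_{s+1}: the form v² − αuv − u² changes sign under (u, v) ↦ (v, αv + u).  At
-- (b, a) it equals −Δ with Δ = αab + b² − a², so at (n, w_{t+2}(b, a)) it is ±Δ, and
-- 0 < Δ < w_{t+2}(b, a) places w_{t+2}(b, a) at ⌊γn⌋ or ⌈γn⌉ according to the parity
-- of t.  Moving to (b + k g_t, a − k g_{t-1}) changes w_{t+2} by k(g_t² − g_{t-1} g_{t+1}),
-- which is ∓k by Cassini's identity.
module Submission where

open import Defs
open import Data.Nat using (ℕ; zero; suc; _+_; _*_; _∸_; _≤_; _<_; z≤n; s≤s; _≤?_; NonZero; >-nonZero)
open import Data.Nat.Properties
open import Data.Nat.Divisibility using (_∣_; divides; ∣m+n∣m⇒∣n; ∣-trans; n∣m*n; ∣1⇒≡1; ∣⇒≤)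
open import Data.Nat.Coprimality using (Coprime; coprime-divisor)
open import Data.Nat.Tactic.RingSolver using (solve-∀)
open import Data.Product using (Σ; ∃-syntax; _×_; _,_; proj₁; proj₂; map₁; map₂)
open import Data.Sum using (_⊎_; inj₁; inj₂)
open import Data.Empty using (⊥; ⊥-elim)
open import Function.Bundles using (_⇔_; mk⇔)
open import Relation.Nullary using (yes; no)
open import Relation.Binary.PropositionalEquality

even-suc⇒odd : ∀ {t} → Even (suc t) → Odd t
even-suc⇒odd (zero , ())
even-suc⇒odd (suc k , eq) = k , trans (suc-injective eq) (+-suc k k)

odd-suc⇒even : ∀ {t} → Odd (suc t) → Even t
odd-suc⇒even (k , eq) = k , suc-injective eq

even⊎odd : ∀ t → Even t ⊎ Odd t
even⊎odd zero = inj₁ (0 , refl)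
even⊎odd (suc t) with even⊎odd t
... | inj₁ (k , eq) = inj₂ (k , cong suc eq)
... | inj₂ (k , eq) = inj₁ (suc k , cong suc (trans eq (sym (+-suc k k))))

even⇒¬odd : ∀ {t} → Even t → Odd t → ⊥
even⇒¬odd {zero} _ (_ , ())
even⇒¬odd {suc t} e o = even⇒¬odd (odd-suc⇒even o) (even-suc⇒odd e)

step : ℕ → ℕ × ℕ → ℕ × ℕ
step α p = proj₂ p , α * proj₂ p + proj₁ p

wpair-+ : ∀ α i j x y → wpair α (i + j) x y ≡ wpair α i (w α (suc j) x y) (w α (suc (suc j)) x y)
wpair-+ α zero j x y = refl
wpair-+ α (suc i) j x y = cong (step α) (wpair-+ α i j x y)

w-positive : ∀ α {x y} → 1 ≤ x → 1 ≤ y → ∀ k → 1 ≤ w α (suc k) x y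
w-positive α 1≤x 1≤y zero = 1≤x
w-positive α 1≤x 1≤y (suc zero) = 1≤y
w-positive α 1≤x 1≤y (suc (suc k)) = ≤-trans (w-positive α 1≤x 1≤y k) (m≤n+m _ _)

w-closedForm : ∀ α t x y → w α (2 + t) x y ≡ y * g α (suc t) + x * g α t
w-closedForm α zero x y = base x y
  where
  base : ∀ x y → y ≡ y * 1 + x * 0
  base = solve-∀
w-closedForm α (suc zero) x y = base α x y
  where
  base : ∀ α x y → α * y + x ≡ y * (α * 1 + 0) + x * 1
  base = solve-∀
w-closedForm α (suc (suc t)) x y = begin
  α * w α (3 + t) x y + w α (2 + t) x y
    ≡⟨ cong₂ (λ u v → α * u + v) (w-closedForm α (suc t) x y) (w-closedForm α t x y) ⟩
  α * (y * G₂ + x * G₁) + (y * G₁ + x * G₀)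
    ≡⟨ regroup α x y G₂ G₁ G₀ ⟩
  y * (α * G₂ + G₁) + x * (α * G₁ + G₀) ∎
  where
  open ≡-Reasoning
  G₀ G₁ G₂ : ℕ
  G₀ = g α t
  G₁ = g α (suc t)
  G₂ = g α (2 + t)
  regroup : ∀ α x y G₂ G₁ G₀ →
    α * (y * G₂ + x * G₁) + (y * G₁ + x * G₀) ≡ y * (α * G₂ + G₁) + x * (α * G₁ + G₀)
  regroup = solve-∀

g-positive : ∀ {α} → 1 ≤ α → ∀ t → 1 ≤ g α (suc t)
g-positive 1≤α zero = s≤s z≤n
g-positive 1≤α (suc t) = ≤-trans (*-mono-≤ 1≤α (g-positive 1≤α t)) (m≤m+n _ _)

g-coprime : ∀ α t → Coprime (g α (suc t)) (g α t)
g-coprime α zero (d∣1 , _) = ∣1⇒≡1 d∣1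
g-coprime α (suc t) (d∣g₂ , d∣g₁) =
  g-coprime α t (d∣g₁ , ∣m+n∣m⇒∣n d∣g₂ (∣-trans d∣g₁ (n∣m*n α)))

wpair-0-1 : ∀ α t → wpair α t 0 1 ≡ (g α t , g α (suc t))
wpair-0-1 α zero = refl
wpair-0-1 α (suc t) = cong (step α) (wpair-0-1 α t)

NegForm PosForm : ℕ → ℕ → ℕ × ℕ → Set
NegForm α c (u , v) = v * v + c ≡ α * u * v + u * u
PosForm α c (u , v) = v * v ≡ α * u * v + u * u + c

step-square : ∀ α u v → (α * v + u) * (α * v + u) ≡ α * v * (α * v + u) + (α * u * v + u * u)
step-square = solve-∀

negForm-step : ∀ α c p → NegForm α c p → PosForm α c (step α p)
negForm-step α c (u , v) form = begin
  (α * v + u) * (α * v + u)                  ≡⟨ step-square α u v ⟩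
  α * v * (α * v + u) + (α * u * v + u * u)  ≡⟨ cong (α * v * (α * v + u) +_) (sym form) ⟩
  α * v * (α * v + u) + (v * v + c)          ≡⟨ +-assoc (α * v * (α * v + u)) (v * v) c ⟨
  α * v * (α * v + u) + v * v + c            ∎
  where open ≡-Reasoning

posForm-step : ∀ α c p → PosForm α c p → NegForm α c (step α p)
posForm-step α c (u , v) form = begin
  (α * v + u) * (α * v + u) + c                  ≡⟨ cong (_+ c) (step-square α u v) ⟩
  α * v * (α * v + u) + (α * u * v + u * u) + c  ≡⟨ +-assoc (α * v * (α * v + u)) _ c ⟩
  α * v * (α * v + u) + (α * u * v + u * u + c)  ≡⟨ cong (α * v * (α * v + u) +_) (sym form) ⟩
  α * v * (α * v + u) + v * v                    ∎
  where open ≡-Reasoning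

module _ (α : ℕ) {P Q : ℕ × ℕ → Set}
         (P⇒Q : ∀ p → P p → Q (step α p)) (Q⇒P : ∀ p → Q p → P (step α p)) where

  alternation : ∀ {x y} → P (x , y) → ∀ t →
                (Even t → P (wpair α t x y)) × (Odd t → Q (wpair α t x y))
  alternation P₀ zero = (λ _ → P₀) , λ { (_ , ()) }
  alternation P₀ (suc t) =
      (λ e → Q⇒P _ (proj₂ (alternation P₀ t) (even-suc⇒odd e)))
    , (λ o → P⇒Q _ (proj₁ (alternation P₀ t) (odd-suc⇒even o)))

cassini : ∀ α t → (Even t → PosForm α 1 (g α t , g α (suc t)))
                × (Odd t → NegForm α 1 (g α t , g α (suc t)))
cassini α t =
    (λ e → subst (PosForm α 1) (wpair-0-1 α t) (proj₁ alternating e))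
  , (λ o → subst (NegForm α 1) (wpair-0-1 α t) (proj₂ alternating o))
  where
  start : PosForm α 1 (0 , 1)
  start = cong (λ z → z * 1 + 0 * 0 + 1) (sym (*-zeroʳ α))
  alternating : (Even t → PosForm α 1 (wpair α t 0 1)) × (Odd t → NegForm α 1 (wpair α t 0 1))
  alternating = alternation α (posForm-step α 1) (negForm-step α 1) start t

m+k*[n+1]≡m+k+k*n : ∀ m k n → m + k * (n + 1) ≡ m + k + k * n
m+k*[n+1]≡m+k+k*n = solve-∀

-- (b + k g_{t+1}, a − k g_t) has the same w_{t+2} as (b, a), and its w_{t+3} differs
-- by k(g_{t+1}² − g_t g_{t+2}); written with a + k g_t on the right to avoid subtraction.
w-next-shift : ∀ α t b a k →
  w α (3 + t) (b + k * g α (suc t)) a + k * (α * g α t * g α (suc t) + g α t * g α t)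
    ≡ w α (3 + t) b (a + k * g α t) + k * (g α (suc t) * g α (suc t))
w-next-shift α t b a k = begin
  w α (3 + t) (b + k * G) a + k * (α * H * G + H * H)
    ≡⟨ cong (_+ k * (α * H * G + H * H)) (w-closedForm α (suc t) (b + k * G) a) ⟩
  a * (α * G + H) + (b + k * G) * G + k * (α * H * G + H * H)
    ≡⟨ regroup α G H a b k ⟩
  (a + k * H) * (α * G + H) + b * G + k * (G * G)
    ≡⟨ cong (_+ k * (G * G)) (w-closedForm α (suc t) b (a + k * H)) ⟨
  w α (3 + t) b (a + k * H) + k * (G * G) ∎
  where
  open ≡-Reasoning
  G H : ℕ
  G = g α (suc t)
  H = g α t
  regroup : ∀ α G H a b k →
    a * (α * G + H) + (b + k * G) * G + k * (α * H * G + H * H)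
      ≡ (a + k * H) * (α * G + H) + b * G + k * (G * G)
  regroup = solve-∀

w-next-shift-neg : ∀ α t b a k → NegForm α 1 (g α t , g α (suc t)) →
  w α (3 + t) (b + k * g α (suc t)) a + k ≡ w α (3 + t) b (a + k * g α t)
w-next-shift-neg α t b a k cassini-neg = +-cancelʳ-≡ (k * (G * G)) _ _ (begin
  w α (3 + t) (b + k * G) a + k + k * (G * G)      ≡⟨ m+k*[n+1]≡m+k+k*n _ k (G * G) ⟨
  w α (3 + t) (b + k * G) a + k * (G * G + 1)
    ≡⟨ cong (λ z → w α (3 + t) (b + k * G) a + k * z) cassini-neg ⟩
  w α (3 + t) (b + k * G) a + k * (α * H * G + H * H) ≡⟨ w-next-shift α t b a k ⟩
  w α (3 + t) b (a + k * H) + k * (G * G)          ∎)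
  where
  open ≡-Reasoning
  G H : ℕ
  G = g α (suc t)
  H = g α t

w-next-shift-pos : ∀ α t b a k → PosForm α 1 (g α t , g α (suc t)) →
  w α (3 + t) (b + k * g α (suc t)) a ≡ w α (3 + t) b (a + k * g α t) + k
w-next-shift-pos α t b a k cassini-pos = +-cancelʳ-≡ (k * X) _ _ (begin
  w α (3 + t) (b + k * G) a + k * X  ≡⟨ w-next-shift α t b a k ⟩
  w α (3 + t) b (a + k * H) + k * (G * G)  ≡⟨ cong (λ z → w α (3 + t) b (a + k * H) + k * z) cassini-pos ⟩
  w α (3 + t) b (a + k * H) + k * (X + 1)  ≡⟨ m+k*[n+1]≡m+k+k*n _ k X ⟩
  w α (3 + t) b (a + k * H) + k + k * X    ∎)
  where
  open ≡-Reasoning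
  G H X : ℕ
  G = g α (suc t)
  H = g α t
  X = α * H * G + H * H

coprime-linear-solution : ∀ {G H a y d} → 1 ≤ G → Coprime G H → a * G ≡ y * G + d * H →
                          ∃[ j ] d ≡ j * G × y + j * H ≡ a
coprime-linear-solution {G} {H} {a} {y} {d} 1≤G G⊥H aG≡yG+dH =
  j , d≡jG , trans (cong (y +_) (sym e≡jH)) y+e≡a
  where
  instance
    G≢0 : NonZero G
    G≢0 = >-nonZero 1≤G
  y≤a : y ≤ a
  y≤a = *-cancelʳ-≤ y a G (≤-trans (m≤m+n (y * G) (d * H)) (≤-reflexive (sym aG≡yG+dH)))
  e : ℕ
  e = a ∸ y
  y+e≡a : y + e ≡ a
  y+e≡a = m+[n∸m]≡n y≤a
  eG≡dH : e * G ≡ d * H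
  eG≡dH = +-cancelˡ-≡ (y * G) _ _ (begin
    y * G + e * G  ≡⟨ *-distribʳ-+ G y e ⟨
    (y + e) * G    ≡⟨ cong (_* G) y+e≡a ⟩
    a * G          ≡⟨ aG≡yG+dH ⟩
    y * G + d * H  ∎)
    where open ≡-Reasoning
  G∣d : G ∣ d
  G∣d = coprime-divisor G⊥H (divides e (trans (*-comm H d) (sym eG≡dH)))
  j : ℕ
  j = _∣_.quotient G∣d
  d≡jG : d ≡ j * G
  d≡jG = _∣_.equality G∣d
  e≡jH : e ≡ j * H
  e≡jH = *-cancelʳ-≡ e (j * H) G (begin
    e * G      ≡⟨ eG≡dH ⟩
    d * H      ≡⟨ cong (_* H) d≡jG ⟩
    j * G * H  ≡⟨ *-assoc j G H ⟩
    j * (G * H) ≡⟨ cong (j *_) (*-comm G H) ⟩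
    j * (H * G) ≡⟨ *-assoc j H G ⟨
    j * H * G  ∎)
    where open ≡-Reasoning

move-summand : ∀ y G b d H → y * G + (b + d) * H ≡ y * G + d * H + b * H
move-summand = solve-∀

-- Representations of a G + b H differ by multiples of (−H, G), so one with x < b
-- would have x ≤ b − G ≤ 0.
canonical-representation : ∀ {G H a b x y} → 1 ≤ G → Coprime G H → b ≤ G → 1 ≤ x →
  a * G + b * H ≡ y * G + x * H → ∃[ j ] x ≡ b + j * G × y + j * H ≡ a
canonical-representation {G} {H} {a} {b} {x} {y} 1≤G G⊥H b≤G 1≤x eq with b ≤? x
... | yes b≤x with m≤n⇒∃[o]m+o≡n b≤x
...   | d , refl with coprime-linear-solution 1≤G G⊥H
                        (+-cancelʳ-≡ (b * H) _ _ (trans eq (move-summand y G b d H)))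
...     | j , d≡jG , y+jH≡a = j , cong (b +_) d≡jG , y+jH≡a
canonical-representation {G} {H} {a} {b} {x} {y} 1≤G G⊥H b≤G 1≤x eq
    | no b≰x with m≤n⇒∃[o]m+o≡n (<⇒≤ (≰⇒> b≰x))
...   | zero , refl = ⊥-elim (b≰x (≤-reflexive (+-identityʳ x)))
...   | suc d , refl with coprime-linear-solution {a = y} {y = a} 1≤G G⊥H
                            (+-cancelʳ-≡ (x * H) _ _ (trans (sym eq) (move-summand a G x (suc d) H)))
...     | j , d≡jG , _ = ⊥-elim (<⇒≱ (+-mono-≤ 1≤x (∣⇒≤ (divides j d≡jG))) b≤G)

canonical-representation-unique : ∀ {G H a b a′ b′} → 1 ≤ G → Coprime G H →
  1 ≤ b → b ≤ G → 1 ≤ b′ → b′ ≤ G → a * G + b * H ≡ a′ * G + b′ * H → a′ ≡ a × b′ ≡ b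
canonical-representation-unique {G} {b = b} {a′} 1≤G G⊥H 1≤b b≤G 1≤b′ b′≤G eq
  with canonical-representation 1≤G G⊥H b≤G 1≤b′ eq
... | zero , b′≡b+0 , a′+0≡a = trans (sym (+-identityʳ a′)) a′+0≡a , trans b′≡b+0 (+-identityʳ b)
... | suc j , b′≡b+G+jG , _ =
  ⊥-elim (<⇒≱ (≤-trans (+-mono-≤ 1≤b (m≤m+n G (j * G))) (≤-reflexive (sym b′≡b+G+jG))) b′≤G)

IsS-unique : ∀ {α n s s′} → IsS α n s → IsS α n s′ → s ≡ s′
IsS-unique ((1≤s , x , y , 1≤x , 1≤y , w≡n) , maximal)
           ((1≤s′ , x′ , y′ , 1≤x′ , 1≤y′ , w′≡n) , maximal′) =
  ≤-antisym (maximal′ _ x y 1≤s 1≤x 1≤y w≡n) (maximal _ x′ y′ 1≤s′ 1≤x′ 1≤y′ w′≡n)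

-- m ↦ m² − αn·m − n² is convex and ≤ 0 at 0, so its nonpositive set is an initial segment.
≤γ-downward : ∀ {α n p m} → p ≤ m → m ≤γ· n [α= α ] → p ≤γ· n [α= α ]
≤γ-downward {p = zero} _ _ = z≤n
≤γ-downward {α} {n} {suc p} {suc m} p≤m m≤γn = *-cancelˡ-≤ (suc m) (begin
  suc m * (suc p * suc p)              ≡⟨ swap (suc m) (suc p) ⟩
  suc p * (suc m * suc p)              ≤⟨ *-monoʳ-≤ (suc p) (*-monoʳ-≤ (suc m) p≤m) ⟩
  suc p * (suc m * suc m)              ≤⟨ *-monoʳ-≤ (suc p) m≤γn ⟩
  suc p * (α * n * suc m + n * n)      ≡⟨ spread α n (suc m) (suc p) ⟩
  suc m * (α * n * suc p) + suc p * (n * n)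
    ≤⟨ +-monoʳ-≤ (suc m * (α * n * suc p)) (*-monoˡ-≤ (n * n) p≤m) ⟩
  suc m * (α * n * suc p) + suc m * (n * n) ≡⟨ *-distribˡ-+ (suc m) (α * n * suc p) (n * n) ⟨
  suc m * (α * n * suc p + n * n)      ∎)
  where
  open ≤-Reasoning
  swap : ∀ m p → m * (p * p) ≡ p * (m * p)
  swap = solve-∀
  spread : ∀ α n m p → p * (α * n * m + n * n) ≡ m * (α * n * p) + p * (n * n)
  spread = solve-∀

γ≤-upward : ∀ {α n m p} → 1 ≤ n → m ≤ p → γ· n ≤ m [α= α ] → γ· n ≤ p [α= α ]
γ≤-upward {α} {n} {m} 1≤n m≤p γn≤m with m≤n⇒∃[o]m+o≡n m≤p
... | d , refl = begin
  α * n * (m + d) + n * n          ≡⟨ split (α * n) m d (n * n) ⟩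
  α * n * d + (α * n * m + n * n)  ≤⟨ +-mono-≤ (*-monoˡ-≤ d αn≤m+d) γn≤m ⟩
  (m + d) * d + m * m              ≤⟨ +-monoʳ-≤ ((m + d) * d) (*-monoʳ-≤ m (m≤m+n m d)) ⟩
  (m + d) * d + m * (m + d)        ≡⟨ square m d ⟩
  (m + d) * (m + d)                ∎
  where
  open ≤-Reasoning
  αn<m : α * n < m
  αn<m = *-cancelʳ-< m (α * n) m (≤-trans (m<m+n (α * n * m) (*-mono-≤ 1≤n 1≤n)) γn≤m)
  αn≤m+d : α * n ≤ m + d
  αn≤m+d = ≤-trans (<⇒≤ αn<m) (m≤m+n m d)
  split : ∀ A m d N → A * (m + d) + N ≡ A * d + (A * m + N)
  split = solve-∀
  square : ∀ m d → (m + d) * d + m * (m + d) ≡ (m + d) * (m + d)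
  square = solve-∀

floor-ceil-between : ∀ {α n m F C} → 1 ≤ n →
  m * m < α * n * m + n * n → α * n * suc m + n * n < suc m * suc m →
  IsFloorγ α n F → IsCeilγ α n C → F ≡ m × C ≡ suc m
floor-ceil-between {α} {n} 1≤n below above (F≤γn , F-maximal) (γn≤C , C-minimal) =
    ≤-antisym (≮⇒≥ λ m<F → <⇒≱ above (≤γ-downward {α} {n} m<F F≤γn)) (F-maximal _ (<⇒≤ below))
  , ≤-antisym (C-minimal _ (<⇒≤ above))
              (≮⇒≥ λ C<1+m → <⇒≱ below (γ≤-upward {α} 1≤n (≤-pred C<1+m) γn≤C))

negForm⇒floor-ceil : ∀ {α n Δ W F C} → 1 ≤ n → NegForm α Δ (n , W) →
  1 ≤ Δ → α * n < W → Δ < W → IsFloorγ α n F → IsCeilγ α n C → F ≡ W × C ≡ suc W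
negForm⇒floor-ceil {α} {n} {Δ} {W} 1≤n form 1≤Δ αn<W Δ<W = floor-ceil-between {α} 1≤n below above
  where
  open ≤-Reasoning
  below : W * W < α * n * W + n * n
  below = begin-strict
    W * W                  <⟨ m<m+n (W * W) 1≤Δ ⟩
    W * W + Δ              ≡⟨ form ⟩
    α * n * W + n * n      ∎
  split : ∀ A W N → A * suc W + N ≡ A + (A * W + N)
  split = solve-∀
  square : ∀ W → suc (W + (W * W + W)) ≡ suc W * suc W
  square = solve-∀
  above : α * n * suc W + n * n < suc W * suc W
  above = begin-strict
    α * n * suc W + n * n        ≡⟨ split (α * n) W (n * n) ⟩
    α * n + (α * n * W + n * n)  ≡⟨ cong (α * n +_) form ⟨
    α * n + (W * W + Δ)          ≤⟨ +-mono-≤ (<⇒≤ αn<W) (+-monoʳ-≤ (W * W) (<⇒≤ Δ<W)) ⟩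
    W + (W * W + W)              <⟨ n<1+n _ ⟩
    suc (W + (W * W + W))        ≡⟨ square W ⟩
    suc W * suc W                ∎

posForm⇒floor-ceil : ∀ {α n Δ W F C} → 1 ≤ n → PosForm α Δ (n , W) →
  1 ≤ Δ → α * n < W → Δ < W → IsFloorγ α n F → IsCeilγ α n C → suc F ≡ W × C ≡ W
posForm⇒floor-ceil {W = zero} _ _ _ () _
posForm⇒floor-ceil {α} {n} {Δ} {suc m} 1≤n form 1≤Δ αn<W Δ<W isFloor isCeil =
  map₁ (cong suc) (floor-ceil-between {α} 1≤n below above isFloor isCeil)
  where
  open ≤-Reasoning
  square : ∀ m → suc (m * m) + (m + m) ≡ suc m * suc m
  square = solve-∀
  split : ∀ A m N Δ → A * suc m + N + Δ ≡ A * m + N + (A + Δ)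
  split = solve-∀
  below : m * m < α * n * m + n * n
  below = +-cancelʳ-≤ (α * n + Δ) (suc (m * m)) (α * n * m + n * n) (begin
    suc (m * m) + (α * n + Δ)
      ≤⟨ +-monoʳ-≤ (suc (m * m)) (+-mono-≤ (≤-pred αn<W) (≤-pred Δ<W)) ⟩
    suc (m * m) + (m + m)                ≡⟨ square m ⟩
    suc m * suc m                        ≡⟨ form ⟩
    α * n * suc m + n * n + Δ            ≡⟨ split (α * n) m (n * n) Δ ⟩
    α * n * m + n * n + (α * n + Δ)      ∎)
  above : α * n * suc m + n * n < suc m * suc m
  above = begin-strict
    α * n * suc m + n * n      <⟨ m<m+n _ 1≤Δ ⟩
    α * n * suc m + n * n + Δ  ≡⟨ form ⟨
    suc m * suc m              ∎

floor-ceil-clash : ∀ {W k F C} → W + k ≡ F → W ≡ C + k → C ≡ suc F → ⊥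
floor-ceil-clash {k = k} {C = C} refl refl = <⇒≢ (s≤s (≤-trans (m≤m+n C k) (m≤m+n (C + k) k)))

even⇒iffs : ∀ {t W k F C} → Even t → W + k ≡ F → C ≡ suc F →
  ((W + k ≡ F) ⇔ Even t) × ((W ≡ C + k) ⇔ Odd t)
even⇒iffs e W+k≡F C≡1+F =
    mk⇔ (λ _ → e) (λ _ → W+k≡F)
  , mk⇔ (λ W≡C+k → ⊥-elim (floor-ceil-clash W+k≡F W≡C+k C≡1+F)) (λ o → ⊥-elim (even⇒¬odd e o))

odd⇒iffs : ∀ {t W k F C} → Odd t → W ≡ C + k → C ≡ suc F →
  ((W + k ≡ F) ⇔ Even t) × ((W ≡ C + k) ⇔ Odd t)
odd⇒iffs o W≡C+k C≡1+F =
    mk⇔ (λ W+k≡F → ⊥-elim (floor-ceil-clash W+k≡F W≡C+k C≡1+F)) (λ e → ⊥-elim (even⇒¬odd e o))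
  , mk⇔ (λ _ → o) (λ _ → W≡C+k)

-- The hypotheses of the characterization theorem, with the paper's t written as t + 1.
record Canonical (α n t a b : ℕ) : Set where
  field
    1≤a  : 1 ≤ a
    1≤b  : 1 ≤ b
    a≤αb : a ≤ α * b
    b≤g  : b ≤ g α (suc t)
    n≡   : n ≡ a * g α (suc t) + b * g α t

module _ {α n t a b : ℕ} (1≤α : 1 ≤ α) (canon : Canonical α n t a b) where
  open Canonical canon

  w-canonical≡n : w α (2 + t) b a ≡ n
  w-canonical≡n = trans (w-closedForm α t b a) (sym n≡)

  canonical-ratio : ∀ {x y} → 1 ≤ x → n ≡ y * g α (suc t) + x * g α t → y ≤ α * x
  canonical-ratio {x} {y} 1≤x n≡yG+xH
    with canonical-representation (g-positive 1≤α t) (g-coprime α t) b≤g 1≤x (trans (sym n≡) n≡yG+xH)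
  ... | j , x≡b+jG , y+jH≡a = begin
    y              ≤⟨ m≤m+n y (j * g α t) ⟩
    y + j * g α t  ≡⟨ y+jH≡a ⟩
    a              ≤⟨ a≤αb ⟩
    α * b          ≤⟨ *-monoʳ-≤ α (≤-trans (m≤m+n b (j * g α (suc t))) (≤-reflexive (sym x≡b+jG))) ⟩
    α * x          ∎
    where open ≤-Reasoning

  -- w_{t+3+o}(x, y) = w_{t+2}(P, Y) with Y = αP + w_{o+1}(x, y) > αP.
  w-beyond : ∀ o {x y} → 1 ≤ x → 1 ≤ y → w α (suc (suc t + suc o)) x y ≢ n
  w-beyond o {x} {y} 1≤x 1≤y w≡n =
    <⇒≱ (m<m+n (α * P) (w-positive α 1≤x 1≤y o))
        (canonical-ratio (w-positive α 1≤x 1≤y (suc o)) n≡YG+PH)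
    where
    P Y : ℕ
    P = w α (2 + o) x y
    Y = w α (3 + o) x y
    n≡YG+PH : n ≡ Y * g α (suc t) + P * g α t
    n≡YG+PH = begin
      n                              ≡⟨ w≡n ⟨
      w α (suc (suc t + suc o)) x y  ≡⟨ cong proj₁ (wpair-+ α (suc t) (suc o) x y) ⟩
      w α (2 + t) P Y                ≡⟨ w-closedForm α t P Y ⟩
      Y * g α (suc t) + P * g α t    ∎
      where open ≡-Reasoning

  w-index-bound : ∀ m {x y} → 1 ≤ x → 1 ≤ y → w α m x y ≡ n → m ≤ 2 + t
  w-index-bound m {x} {y} 1≤x 1≤y w≡n with m ≤? 2 + t
  ... | yes m≤2+t = m≤2+t
  ... | no m≰2+t with m≤n⇒∃[o]m+o≡n (≰⇒> m≰2+t)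
  ...   | o , refl =
    ⊥-elim (w-beyond o 1≤x 1≤y (subst (λ i → w α (2 + i) x y ≡ n) (sym (+-suc t o)) w≡n))

  canonical⇒IsS : IsS α n (2 + t)
  canonical⇒IsS = (s≤s z≤n , b , a , 1≤b , 1≤a , w-canonical≡n) , λ m _ _ _ → w-index-bound m

  good⇒shifted : ∀ {b′ a′} → Good α n b′ a′ →
                 ∃[ k ] b′ ≡ b + k * g α (suc t) × a′ + k * g α t ≡ a
  good⇒shifted {b′} {a′} (_ , isS′ , 1≤b′ , _ , w≡n) with IsS-unique isS′ canonical⇒IsS
  ... | refl = canonical-representation (g-positive 1≤α t) (g-coprime α t) b≤g 1≤b′ (begin
    a * g α (suc t) + b * g α t    ≡⟨ n≡ ⟨
    n                              ≡⟨ w≡n ⟨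
    w α (2 + t) b′ a′              ≡⟨ w-closedForm α t b′ a′ ⟩
    a′ * g α (suc t) + b′ * g α t  ∎)
    where open ≡-Reasoning

  W₀ Δ : ℕ
  W₀ = w α (3 + t) b a
  Δ = α * b * a + b * b ∸ a * a

  negForm-start : NegForm α Δ (b , a)
  negForm-start = m+[n∸m]≡n (≤-trans (*-monoˡ-≤ a a≤αb) (m≤m+n (α * b * a) (b * b)))

  1≤Δ : 1 ≤ Δ
  1≤Δ = ≤-trans (*-mono-≤ 1≤b 1≤b) (+-cancelˡ-≤ (a * a) (b * b) Δ (begin
    a * a + b * b      ≤⟨ +-monoˡ-≤ (b * b) (*-monoˡ-≤ a a≤αb) ⟩
    α * b * a + b * b  ≡⟨ negForm-start ⟨
    a * a + Δ          ∎))
    where open ≤-Reasoning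

  Δ<W₀ : Δ < W₀
  Δ<W₀ = begin-strict
    Δ                                  <⟨ m<n+m Δ (*-mono-≤ 1≤a 1≤a) ⟩
    a * a + Δ                          ≡⟨ negForm-start ⟩
    α * b * a + b * b                  ≤⟨ +-mono-≤ αba≤aG′ (*-monoʳ-≤ b b≤g) ⟩
    a * g α (2 + t) + b * g α (suc t)  ≡⟨ w-closedForm α (suc t) b a ⟨
    W₀                                 ∎
    where
    open ≤-Reasoning
    αba≤aG′ : α * b * a ≤ a * g α (2 + t)
    αba≤aG′ = begin
      α * b * a                       ≡⟨ *-comm (α * b) a ⟩
      a * (α * b)                     ≤⟨ *-monoʳ-≤ a (*-monoʳ-≤ α b≤g) ⟩
      a * (α * g α (suc t))           ≤⟨ *-monoʳ-≤ a (m≤m+n _ (g α t)) ⟩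
      a * g α (2 + t)                 ∎

  αn<W₀ : α * n < W₀
  αn<W₀ = subst (λ u → α * u < W₀) w-canonical≡n (m<m+n _ (w-positive α 1≤b 1≤a t))

  1≤n : 1 ≤ n
  1≤n = subst (1 ≤_) w-canonical≡n (w-positive α 1≤b 1≤a (suc t))

  form-at-n : (Even (suc t) → NegForm α Δ (n , W₀)) × (Odd (suc t) → PosForm α Δ (n , W₀))
  form-at-n =
      (λ e → subst (λ u → NegForm α Δ (u , W₀)) w-canonical≡n (proj₁ alternating e))
    , (λ o → subst (λ u → PosForm α Δ (u , W₀)) w-canonical≡n (proj₂ alternating o))
    where
    alternating : (Even (suc t) → NegForm α Δ (wpair α (suc t) b a))
                × (Odd (suc t) → PosForm α Δ (wpair α (suc t) b a))
    alternating = alternation α (negForm-step α Δ) (posForm-step α Δ) negForm-start (suc t)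

  w-next-even : ∀ {k a′} → Even (suc t) → a′ + k * g α t ≡ a →
                w α (3 + t) (b + k * g α (suc t)) a′ + k ≡ W₀
  w-next-even {k} {a′} e a′+kH≡a =
    trans (w-next-shift-neg α t b a′ k (proj₂ (cassini α t) (even-suc⇒odd e)))
          (cong (w α (3 + t) b) a′+kH≡a)

  w-next-odd : ∀ {k a′} → Odd (suc t) → a′ + k * g α t ≡ a →
               w α (3 + t) (b + k * g α (suc t)) a′ ≡ W₀ + k
  w-next-odd {k} {a′} o a′+kH≡a =
    trans (w-next-shift-pos α t b a′ k (proj₁ (cassini α t) (odd-suc⇒even o)))
          (cong (λ z → w α (3 + t) b z + k) a′+kH≡a)

  w-next-shifted : ∀ {s k b′ a′ F C} → IsS α n s →
    b′ ≡ b + k * g α (suc t) → a′ + k * g α t ≡ a → IsFloorγ α n F → IsCeilγ α n C →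
    ((w α (suc s) b′ a′ + k ≡ F) ⇔ Even (suc t)) × ((w α (suc s) b′ a′ ≡ C + k) ⇔ Odd (suc t))
  w-next-shifted isS refl a′+kH≡a isFloor isCeil with IsS-unique canonical⇒IsS isS | even⊎odd (suc t)
  ... | refl | inj₁ e
    with negForm⇒floor-ceil {α} 1≤n (proj₁ form-at-n e) 1≤Δ αn<W₀ Δ<W₀ isFloor isCeil
  ...   | refl , C≡1+W₀ = even⇒iffs e (w-next-even e a′+kH≡a) C≡1+W₀
  w-next-shifted isS refl a′+kH≡a isFloor isCeil
      | refl | inj₂ o
    with posForm⇒floor-ceil {α} 1≤n (proj₂ form-at-n o) 1≤Δ αn<W₀ Δ<W₀ isFloor isCeil
  ...   | 1+F≡W₀ , refl = odd⇒iffs o (w-next-odd o a′+kH≡a) (sym 1+F≡W₀)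

canonical-unique : ∀ {α n t a b t′ a′ b′} → 1 ≤ α →
  Canonical α n t a b → Canonical α n t′ a′ b′ → a′ ≡ a × b′ ≡ b × t′ ≡ t
canonical-unique {α} {t = t} 1≤α c c′ with IsS-unique (canonical⇒IsS 1≤α c′) (canonical⇒IsS 1≤α c)
... | refl =
  let a′≡a , b′≡b = canonical-representation-unique (g-positive 1≤α t) (g-coprime α t)
                      (Canonical.1≤b c) (Canonical.b≤g c) (Canonical.1≤b c′) (Canonical.b≤g c′)
                      (trans (sym (Canonical.n≡ c)) (Canonical.n≡ c′))
  in a′≡a , b′≡b , refl

corollary4 : ∀ (α n s a b t : ℕ) → 1 ≤ α → IsS α n s → 2 < s →
    -- a, b, t as given by the characterization theorem with β = 1
    1 ≤ a → 1 ≤ b → n ≡ a * g α t + b * g α (t ∸ 1) → 2 ≤ t →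
    a ≤ α * b → b ≤ g α t →
    -- (1) a, b, t are the unique integers with n = a g_t + b g_{t-1}, t ≥ 2, 1 ≤ a ≤ αb ≤ α g_t
    ((1 ≤ a × a ≤ α * b × α * b ≤ α * g α t)
      × (∀ (a′ b′ t′ : ℕ) → n ≡ a′ * g α t′ + b′ * g α (t′ ∸ 1) → 2 ≤ t′ →
           1 ≤ a′ → a′ ≤ α * b′ → α * b′ ≤ α * g α t′ →
           a′ ≡ a × b′ ≡ b × t′ ≡ t))
    -- (2) every good pair is (b + k g_t, a − k g_{t-1}) with k ≥ 0
    × (∀ (b′ a′ : ℕ) → Good α n b′ a′ →
         Σ ℕ (λ k → b′ ≡ b + k * g α t × a′ + k * g α (t ∸ 1) ≡ a))
    -- (3) value of w_{s+1} on good pairs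
    × (∀ (k b′ a′ F C : ℕ) → b′ ≡ b + k * g α t → a′ + k * g α (t ∸ 1) ≡ a →
         Good α n b′ a′ → IsFloorγ α n F → IsCeilγ α n C →
         ((w α (suc s) b′ a′ + k ≡ F) ⇔ Even t)
         × ((w α (suc s) b′ a′ ≡ C + k) ⇔ Odd t))
corollary4 α n s a b zero _ _ _ _ _ _ () _ _
corollary4 α n s a b (suc t) 1≤α isS _ 1≤a 1≤b n≡ _ a≤αb b≤g =
    ((1≤a , a≤αb , *-monoʳ-≤ α b≤g) , unique)
  , (λ _ _ → good⇒shifted 1≤α canon)
  , (λ _ _ _ _ _ b′≡ a′+kH≡a _ → w-next-shifted 1≤α canon isS b′≡ a′+kH≡a)
  where
  canon : Canonical α n t a b
  canon = record { 1≤a = 1≤a ; 1≤b = 1≤b ; a≤αb = a≤αb ; b≤g = b≤g ; n≡ = n≡ }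
  unique : ∀ (a′ b′ t′ : ℕ) → n ≡ a′ * g α t′ + b′ * g α (t′ ∸ 1) → 2 ≤ t′ →
           1 ≤ a′ → a′ ≤ α * b′ → α * b′ ≤ α * g α t′ → a′ ≡ a × b′ ≡ b × t′ ≡ suc t
  unique _ _ zero _ ()
  unique _ zero _ _ _ 1≤a′ a′≤α*0 _ =
    ⊥-elim (<⇒≱ (≤-trans 1≤a′ a′≤α*0) (≤-reflexive (*-zeroʳ α)))
  unique a′ (suc b′) (suc t′) n≡′ _ 1≤a′ a′≤αb′ αb′≤αg′ =
    map₂ (map₂ (cong suc)) (canonical-unique 1≤α canon (record
      { 1≤a = 1≤a′ ; 1≤b = s≤s z≤n ; a≤αb = a′≤αb′ ; n≡ = n≡′
      ; b≤g = *-cancelˡ-≤ α {{>-nonZero 1≤α}} αb′≤αg′ }))
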